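{- Let $B$ be a unital algebra over a field of characteristic zero and $f=I\cdot F\in G^I_B$ with $F\in G^{\mathrm{inv}}_B$. Then $$S_f^{ -1}\cdot I\cdot S_f=(F\cdot I)\circ(I\cdot S_f)=(F\cdot I)\circ(I\cdot F)^{\circ-1}.$$
   Context: $\mathrm{Mult}[[B]]$: sequences $f=(f_n)_{n\ge0}$ with $f_n:B^n\to B$ multilinear ($f_0\in B$). Product: $(f\cdot g)_n(x_1,\dots,x_n)=\sum_{k=0}^nf_k(x_1,\dots,x_k)g_{n-k}(x_{k+1},\dots,x_n)$. Composition (for $g_0=0$): $(f\circ g)_n(x_1,\dots,x_n)=\sum_{l\ge0}\sum_{k_1+\dots+k_l=n,k_i\ge1}f_l(g_{k_1}(x_1,\dots,x_{k_1}),\dots,g_{k_l}(x_{n-k_l+1},\dots,x_n))$. $I$: $I_1=\mathrm{Id}_B$, $I_n=0$ otherwise. $G^{\mathrm{inv}}_B=\{f:f_0\in B^\times\}$ (group under $\cdot$, inverse $f^{ -1}$), $G^{\mathrm{dif}}_B=\{f:f_0=0,f_1\in GL(B)\}$ (group under $\circ$, inverse $f^{\circ-1}$), $G^I_B=I\cdot G^{\mathrm{inv}}_B$. For $f\in G^I_B$, $S_f\in G^{\mathrm{inv}}_B$ is the unique element with $f^{\circ-1}=I\cdot S_f$. -}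

module Defs where

open import Level using (Level; _⊔_) renaming (suc to lsuc)
open import Data.Nat using (ℕ; zero; suc)
open import Data.Product using (_×_; _,_; ∃; Σ)
open import Data.List using (List; []; _∷_; [_]; _++_; map; foldr; concatMap)
open import Data.List.Relation.Binary.Pointwise using (Pointwise)
open import Relation.Binary.PropositionalEquality using (_≡_)
open import Relation.Nullary using (¬_)
open import Algebra.Bundles using (CommutativeRing; Ring)

module _ {c ℓ} (K : CommutativeRing c ℓ) where
  open CommutativeRing K

  ℕ→K : ℕ → Carrier
  ℕ→K zero    = 0#
  ℕ→K (suc n) = 1# + ℕ→K n

  record IsField : Set (c ⊔ ℓ) where
    field
      1≉0     : ¬ (1# ≈ 0#)
      inverse : ∀ x → ¬ (x ≈ 0#) → ∃ λ y → x * y ≈ 1#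

  CharacteristicZero : Set ℓ
  CharacteristicZero = ∀ n → ℕ→K n ≈ 0# → n ≡ 0

record UnitalAlgebra {c ℓ} (K : CommutativeRing c ℓ) (b ℓb : Level)
       : Set (c ⊔ ℓ ⊔ lsuc (b ⊔ ℓb)) where
  private module K = CommutativeRing K
  field
    ring : Ring b ℓb
  open Ring ring public
  infixr 7 _•_
  field
    _•_       : K.Carrier → Carrier → Carrier
    •-cong    : ∀ {a a′ x x′} → a K.≈ a′ → x ≈ x′ → a • x ≈ a′ • x′
    •-distribˡ : ∀ a x y → a • (x + y) ≈ a • x + a • y
    •-distribʳ : ∀ a a′ x → (a K.+ a′) • x ≈ a • x + a′ • x
    •-assoc   : ∀ a a′ x → (a K.* a′) • x ≈ a • (a′ • x)
    •-identity : ∀ x → K.1# • x ≈ x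
    •-*-assocˡ : ∀ a x y → (a • x) * y ≈ a • (x * y)
    •-*-assocʳ : ∀ a x y → x * (a • y) ≈ a • (x * y)

-- A sequence f = (f_n)_{n≥0}, f_n : B^n → B, is encoded as a single
-- function on lists: f_n(x_1,…,x_n) = f (x_1 ∷ … ∷ x_n ∷ []).
-- (List B is the disjoint union of the B^n; f_0 = f [].)

module MultSeries {c ℓ b ℓb} {K : CommutativeRing c ℓ}
                  (A : UnitalAlgebra K b ℓb) where
  open UnitalAlgebra A
  private module K = CommutativeRing K

  Mult : Set b
  Mult = List Carrier → Carrier

  record IsMultilinear (f : Mult) : Set (c ⊔ b ⊔ ℓb) where
    field
      cong     : ∀ {xs ys} → Pointwise _≈_ xs ys → f xs ≈ f ys
      additive : ∀ us vs x y →
                 f (us ++ (x + y) ∷ vs) ≈ f (us ++ x ∷ vs) + f (us ++ y ∷ vs)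
      homog    : ∀ us vs a x →
                 f (us ++ (a • x) ∷ vs) ≈ a • f (us ++ x ∷ vs)

  infix 4 _≋_
  _≋_ : Mult → Mult → Set (b ⊔ ℓb)
  f ≋ g = ∀ xs → f xs ≈ g xs

  Σ-list : List Carrier → Carrier
  Σ-list = foldr _+_ 0#

  splits : List Carrier → List (List Carrier × List Carrier)
  splits []       = ([] , []) ∷ []
  splits (x ∷ xs) = ([] , x ∷ xs) ∷ map (λ { (ys , zs) → (x ∷ ys , zs) }) (splits xs)

  -- all ways to cut xs into l ≥ 0 consecutive nonempty blocks
  -- (i.e. compositions k_1 + … + k_l = n with k_i ≥ 1)
  private
    extend : Carrier → List (List Carrier) → List (List (List Carrier))
    extend x []       = []
    extend x (b ∷ bs) = ((x ∷ b) ∷ bs) ∷ []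

  blocks : List Carrier → List (List (List Carrier))
  blocks []       = [] ∷ []
  blocks (x ∷ xs) = concatMap (λ p → ([ x ] ∷ p) ∷ extend x p) (blocks xs)

  infixl 7 _·_
  _·_ : Mult → Mult → Mult
  (f · g) xs = Σ-list (map (λ { (ys , zs) → f ys * g zs }) (splits xs))

  -- composition (used for g_0 = 0):
  --   (f∘g)_n(x) = Σ_l Σ_{k_1+…+k_l=n, k_i≥1} f_l(g_{k_1}(…),…,g_{k_l}(…))
  infixr 9 _⊚_
  _⊚_ : Mult → Mult → Mult
  (f ⊚ g) xs = Σ-list (map (λ bs → f (map g bs)) (blocks xs))

  I : Mult
  I (x ∷ []) = x
  I _        = 0#

  𝟙 : Mult
  𝟙 []      = 1#
  𝟙 (_ ∷ _) = 0#

  InGinv : Mult → Set (b ⊔ ℓb)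
  InGinv f = ∃ λ u → (f [] * u ≈ 1#) × (u * f [] ≈ 1#)

  IsMulInverse : Mult → Mult → Set (b ⊔ ℓb)
  IsMulInverse f g = (f · g ≋ 𝟙) × (g · f ≋ 𝟙)

  IsCompInverse : Mult → Mult → Set (b ⊔ ℓb)
  IsCompInverse f g = (f ⊚ g ≋ I) × (g ⊚ f ≋ I)

{-# OPTIONS --safe #-}

-- Right composition is multiplicative, (f · k) ⊚ g ≋ (f ⊚ g) · (k ⊚ g), and
-- I ⊚ g ≋ g when g₀ = 0.  Applied to (I · F) ⊚ (I · S) ≋ I this gives
-- I · (S · (F ⊚ (I · S))) ≋ I, so F ⊚ (I · S) ≋ S⁻¹ and hence
-- (F · I) ⊚ (I · S) ≋ S⁻¹ · I · S.  For the second identity, (I · F)^{∘-1} is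
-- unique: h(x₁,…,xₙ) enters ((I · F) ⊚ h)ₙ only through the one-block term
-- h(x₁,…,xₙ) · F₀, every other term involves h on fewer arguments, and F₀ is
-- invertible.

module Submission where

open import Defs
open import Level using (_⊔_)
open import Data.Product as Product using (_×_; _,_; proj₁; proj₂; uncurry)
open import Data.Nat using (_<_; s≤s; z≤n)
open import Data.Nat.Properties using (m<n⇒m<1+n; n<1+n)
open import Data.Nat.Induction using (<-wellFounded)
open import Data.List using (List; []; _∷_; [_]; _++_; map; concatMap; length)
open import Data.List.Properties using (map-∘)
open import Data.List.Relation.Unary.All as All using (All; []; _∷_)
open import Data.List.Relation.Binary.Pointwise as Pointwise using (Pointwise; []; _∷_)
open import Relation.Binary.PropositionalEquality as ≡ using (_≡_)
import Relation.Binary.Construct.On as On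
import Induction.WellFounded as WF
open import Algebra.Bundles using (CommutativeRing; Monoid)
import Algebra.Properties.CommutativeSemigroup as CommutativeSemigroupProperties
import Algebra.Properties.AbelianGroup as AbelianGroupProperties
import Algebra.Properties.Group as GroupProperties
import Algebra.Properties.Monoid as MonoidProperties

module MultSeriesProperties {c ℓ b ℓb} {K : CommutativeRing c ℓ}
                            (A : UnitalAlgebra K b ℓb) where
  open UnitalAlgebra A
  open MultSeries A
  open import Relation.Binary.Reasoning.Setoid setoid
  open CommutativeSemigroupProperties +-commutativeSemigroup using (interchange)
  open AbelianGroupProperties +-abelianGroup using (⁻¹-∙-comm)
  open GroupProperties +-group using (ε⁻¹≈ε; x∙y⁻¹≈ε⇒x≈y; x≈y⇒x∙y⁻¹≈ε)
  open MonoidProperties *-monoid using (cancelʳ)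

  Blocks : Set b
  Blocks = List (List Carrier)

  ∑ : ∀ {x} {X : Set x} → List X → (X → Carrier) → Carrier
  ∑ l f = Σ-list (map f l)

  ∑-syntax : ∀ {x} {X : Set x} → List X → (X → Carrier) → Carrier
  ∑-syntax = ∑
  infix 8 ∑-syntax
  syntax ∑-syntax l (λ a → e) = ∑[ a ∈ l ] e

  module _ {x} {X : Set x} where

    ∑-cong : ∀ (l : List X) {f g : X → Carrier} → (∀ a → f a ≈ g a) → ∑ l f ≈ ∑ l g
    ∑-cong []      _   = refl
    ∑-cong (a ∷ l) f≈g = +-cong (f≈g a) (∑-cong l f≈g)

    ∑-zero : ∀ (l : List X) {f : X → Carrier} → (∀ a → f a ≈ 0#) → ∑ l f ≈ 0#
    ∑-zero []      _   = refl
    ∑-zero (a ∷ l) f≈0 = trans (+-cong (f≈0 a) (∑-zero l f≈0)) (+-identityˡ 0#)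

    ∑-+ : ∀ (l : List X) (f g : X → Carrier) → ∑[ a ∈ l ] (f a + g a) ≈ ∑ l f + ∑ l g
    ∑-+ []      f g = sym (+-identityˡ 0#)
    ∑-+ (a ∷ l) f g = trans (+-cong refl (∑-+ l f g)) (interchange (f a) (g a) _ _)

    ∑-neg : ∀ (l : List X) (f : X → Carrier) → ∑[ a ∈ l ] (- f a) ≈ - ∑ l f
    ∑-neg []      f = sym ε⁻¹≈ε
    ∑-neg (a ∷ l) f = trans (+-cong refl (∑-neg l f)) (⁻¹-∙-comm _ _)

    ∑-- : ∀ (l : List X) (f g : X → Carrier) → ∑[ a ∈ l ] (f a - g a) ≈ ∑ l f - ∑ l g
    ∑-- l f g = trans (∑-+ l f (λ a → - g a)) (+-cong refl (∑-neg l g))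

    *-distribˡ-∑ : ∀ (l : List X) y (f : X → Carrier) → y * ∑ l f ≈ ∑[ a ∈ l ] (y * f a)
    *-distribˡ-∑ []      y f = zeroʳ y
    *-distribˡ-∑ (a ∷ l) y f = trans (distribˡ y (f a) _) (+-cong refl (*-distribˡ-∑ l y f))

    *-distribʳ-∑ : ∀ (l : List X) y (f : X → Carrier) → ∑ l f * y ≈ ∑[ a ∈ l ] (f a * y)
    *-distribʳ-∑ []      y f = zeroˡ y
    *-distribʳ-∑ (a ∷ l) y f = trans (distribʳ y (f a) _) (+-cong refl (*-distribʳ-∑ l y f))

    ∑-++ : ∀ (l m : List X) (f : X → Carrier) → ∑ (l ++ m) f ≈ ∑ l f + ∑ m f
    ∑-++ []      m f = sym (+-identityˡ _)
    ∑-++ (a ∷ l) m f = trans (+-cong refl (∑-++ l m f)) (sym (+-assoc _ _ _))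

    ∑-concatMap : ∀ {y} {Y : Set y} (g : Y → List X) (l : List Y) (f : X → Carrier) →
                  ∑ (concatMap g l) f ≈ ∑[ a ∈ l ] ∑ (g a) f
    ∑-concatMap g []      f = refl
    ∑-concatMap g (a ∷ l) f = trans (∑-++ (g a) (concatMap g l) f) (+-cong refl (∑-concatMap g l f))

    ∑-map : ∀ {y} {Y : Set y} (h : Y → X) (l : List Y) (f : X → Carrier) →
            ∑ (map h l) f ≡ ∑[ a ∈ l ] f (h a)
    ∑-map h l f = ≡.cong Σ-list (≡.sym (map-∘ l))

  ∑-*-∑ : ∀ {x y} {X : Set x} {Y : Set y} (l : List X) (m : List Y)
          (f : X → Carrier) (g : Y → Carrier) →
          ∑ l f * ∑ m g ≈ ∑[ a ∈ l ] ∑[ a′ ∈ m ] (f a * g a′)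
  ∑-*-∑ l m f g = trans (*-distribʳ-∑ l _ f) (∑-cong l (λ a → *-distribˡ-∑ m (f a) g))

  splits′ : ∀ {x} {X : Set x} → List X → List (List X × List X)
  splits′ []       = ([] , []) ∷ []
  splits′ (x ∷ xs) = ([] , x ∷ xs) ∷ map (Product.map₁ (x ∷_)) (splits′ xs)

  ∑-splits′-∷ : ∀ {x} {X : Set x} (y : X) ys (φ : List X × List X → Carrier) →
    ∑ (splits′ (y ∷ ys)) φ ≡ φ ([] , y ∷ ys) + ∑[ s ∈ splits′ ys ] φ (Product.map₁ (y ∷_) s)
  ∑-splits′-∷ y ys φ = ≡.cong (φ ([] , y ∷ ys) +_) (∑-map _ (splits′ ys) φ)

  ∑-splits-∷ : ∀ y ys (φ : List Carrier × List Carrier → Carrier) →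
    ∑ (splits (y ∷ ys)) φ ≡ φ ([] , y ∷ ys) + ∑[ s ∈ splits ys ] φ (Product.map₁ (y ∷_) s)
  ∑-splits-∷ y ys φ = ≡.cong (φ ([] , y ∷ ys) +_) (∑-map _ (splits ys) φ)

  splits-map : ∀ (g : List Carrier → Carrier) (p : Blocks) →
    splits (map g p) ≡ map (Product.map (map g) (map g)) (splits′ p)
  splits-map g []      = ≡.refl
  splits-map g (q ∷ p) = ≡.cong (([] , g q ∷ map g p) ∷_)
    (≡.trans (≡.cong (map _) (splits-map g p))
             (≡.trans (≡.sym (map-∘ (splits′ p))) (map-∘ (splits′ p))))

  ∑-splits-assoc : ∀ xs (φ : List Carrier → List Carrier → List Carrier → Carrier) →
    ∑[ s ∈ splits xs ] ∑[ t ∈ splits (proj₁ s) ] φ (proj₁ t) (proj₂ t) (proj₂ s)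
    ≈ ∑[ s ∈ splits xs ] ∑[ t ∈ splits (proj₂ s) ] φ (proj₁ s) (proj₁ t) (proj₂ t)
  ∑-splits-assoc []       φ = refl
  ∑-splits-assoc (x ∷ xs) φ = begin
      ∑[ s ∈ splits (x ∷ xs) ] ∑[ t ∈ splits (proj₁ s) ] φ (proj₁ t) (proj₂ t) (proj₂ s)
    ≈⟨ trans (reflexive (∑-splits-∷ x xs _))
             (+-cong (+-identityʳ _)
                     (∑-cong (splits xs) (λ s → reflexive (∑-splits-∷ x (proj₁ s) _)))) ⟩
      φ [] [] (x ∷ xs) + ∑[ s ∈ splits xs ] (φ [] (x ∷ proj₁ s) (proj₂ s) + L s)
    ≈⟨ trans (+-cong refl (∑-+ (splits xs) _ L)) (sym (+-assoc _ _ _)) ⟩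
      (φ [] [] (x ∷ xs) + ∑[ s ∈ splits xs ] φ [] (x ∷ proj₁ s) (proj₂ s)) + ∑ (splits xs) L
    ≈⟨ +-cong refl (∑-splits-assoc xs φₓ) ⟩
      (φ [] [] (x ∷ xs) + ∑[ s ∈ splits xs ] φ [] (x ∷ proj₁ s) (proj₂ s)) + R
    ≡⟨ ≡.cong (_+ R) (∑-splits-∷ x xs _) ⟨
      ∑[ t ∈ splits (x ∷ xs) ] φ [] (proj₁ t) (proj₂ t) + R
    ≡⟨ ∑-splits-∷ x xs _ ⟨
      ∑[ s ∈ splits (x ∷ xs) ] ∑[ t ∈ splits (proj₂ s) ] φ (proj₁ s) (proj₁ t) (proj₂ t) ∎
    where
    φₓ : List Carrier → List Carrier → List Carrier → Carrier
    φₓ ys = φ (x ∷ ys)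
    L : List Carrier × List Carrier → Carrier
    L s = ∑[ t ∈ splits (proj₁ s) ] φₓ (proj₁ t) (proj₂ t) (proj₂ s)
    R : Carrier
    R = ∑[ s ∈ splits xs ] ∑[ t ∈ splits (proj₂ s) ] φₓ (proj₁ s) (proj₁ t) (proj₂ t)

  ·-∷ : ∀ f g x xs → (f · g) (x ∷ xs) ≈ f [] * g (x ∷ xs) + ((λ ys → f (x ∷ ys)) · g) xs
  ·-∷ f g x xs = reflexive (∑-splits-∷ x xs _)

  ·-cong : ∀ {f f′ g g′} → f ≋ f′ → g ≋ g′ → f · g ≋ f′ · g′
  ·-cong f≋f′ g≋g′ xs = ∑-cong (splits xs) (λ s → *-cong (f≋f′ (proj₁ s)) (g≋g′ (proj₂ s)))

  ·-assoc : ∀ f g k → (f · g) · k ≋ f · (g · k)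
  ·-assoc f g k xs = begin
      ((f · g) · k) xs
    ≈⟨ ∑-cong (splits xs) (λ s → *-distribʳ-∑ (splits (proj₁ s)) _ _) ⟩
      ∑[ s ∈ splits xs ] ∑[ t ∈ splits (proj₁ s) ] ((f (proj₁ t) * g (proj₂ t)) * k (proj₂ s))
    ≈⟨ ∑-splits-assoc xs (λ ys zs ws → (f ys * g zs) * k ws) ⟩
      ∑[ s ∈ splits xs ] ∑[ t ∈ splits (proj₂ s) ] ((f (proj₁ s) * g (proj₁ t)) * k (proj₂ t))
    ≈⟨ ∑-cong (splits xs) (λ s → trans (∑-cong (splits (proj₂ s)) (λ t → *-assoc _ _ _))
                                        (sym (*-distribˡ-∑ (splits (proj₂ s)) _ _))) ⟩
      (f · (g · k)) xs ∎

  ·-identityˡ : ∀ f → 𝟙 · f ≋ f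
  ·-identityˡ f []       = trans (+-identityʳ _) (*-identityˡ _)
  ·-identityˡ f (x ∷ xs) = trans (·-∷ 𝟙 f x xs)
    (trans (+-cong (*-identityˡ _) (∑-zero (splits xs) (λ _ → zeroˡ _))) (+-identityʳ _))

  ·-identityʳ : ∀ f → f · 𝟙 ≋ f
  ·-identityʳ f []       = trans (+-identityʳ _) (*-identityʳ _)
  ·-identityʳ f (x ∷ xs) = trans (·-∷ f 𝟙 x xs)
    (trans (+-cong (zeroʳ _) (·-identityʳ (λ ys → f (x ∷ ys)) xs)) (+-identityˡ _))

  ≋-refl : ∀ {f} → f ≋ f
  ≋-refl _ = refl

  ≋-sym : ∀ {f g} → f ≋ g → g ≋ f
  ≋-sym f≋g xs = sym (f≋g xs)

  ≋-trans : ∀ {f g k} → f ≋ g → g ≋ k → f ≋ k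
  ≋-trans f≋g g≋k xs = trans (f≋g xs) (g≋k xs)

  ·-monoid : Monoid b (b ⊔ ℓb)
  ·-monoid = record
    { Carrier  = Mult
    ; _≈_      = _≋_
    ; _∙_      = _·_
    ; ε        = 𝟙
    ; isMonoid = record
      { isSemigroup = record
        { isMagma = record
          { isEquivalence = record { refl = ≋-refl ; sym = ≋-sym ; trans = ≋-trans }
          ; ∙-cong        = ·-cong
          }
        ; assoc = ·-assoc
        }
      ; identity = ·-identityˡ , ·-identityʳ
      }
    }

  Congruent : Mult → Set (b ⊔ ℓb)
  Congruent f = ∀ {xs ys} → Pointwise _≈_ xs ys → f xs ≈ f ys

  I-congruent : Congruent I
  I-congruent []          = refl
  I-congruent (x≈y ∷ [])  = x≈y
  I-congruent (_ ∷ _ ∷ _) = refl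

  ·-congruent : ∀ {f g} → Congruent f → Congruent g → Congruent (f · g)
  ·-congruent f-cong g-cong [] = refl
  ·-congruent {f} {g} f-cong g-cong {x ∷ xs} {y ∷ ys} (x≈y ∷ xs≈ys) = begin
      (f · g) (x ∷ xs)
    ≈⟨ ·-∷ f g x xs ⟩
      f [] * g (x ∷ xs) + ((λ zs → f (x ∷ zs)) · g) xs
    ≈⟨ +-cong (*-cong refl (g-cong (x≈y ∷ xs≈ys)))
              (·-cong (λ _ → f-cong (x≈y ∷ Pointwise.refl refl)) ≋-refl xs) ⟩
      f [] * g (y ∷ ys) + ((λ zs → f (y ∷ zs)) · g) xs
    ≈⟨ +-cong refl (·-congruent (λ zs≈ws → f-cong (refl ∷ zs≈ws)) g-cong xs≈ys) ⟩
      f [] * g (y ∷ ys) + ((λ zs → f (y ∷ zs)) · g) ys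
    ≈⟨ ·-∷ f g y ys ⟨
      (f · g) (y ∷ ys) ∎

  map-pointwise : ∀ {g h : Mult} {p : Blocks} → All (λ q → g q ≈ h q) p →
                  Pointwise _≈_ (map g p) (map h p)
  map-pointwise []              = []
  map-pointwise (gq≈hq ∷ gp≈hp) = gq≈hq ∷ map-pointwise gp≈hp

  ⊚-congʳ : ∀ {f g h} → Congruent f → g ≋ h → f ⊚ g ≋ f ⊚ h
  ⊚-congʳ f-cong g≋h xs = ∑-cong (blocks xs) (λ p → f-cong (map-pointwise (All.universal g≋h p)))

  joined : Carrier → (Blocks → Carrier) → Blocks → Carrier
  joined x f []       = 0#
  joined x f (q ∷ qs) = f ((x ∷ q) ∷ qs)

  ∑-blocks-∷ : ∀ x xs (f : Blocks → Carrier) →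
    ∑ (blocks (x ∷ xs)) f ≈ ∑[ p ∈ blocks xs ] (f ([ x ] ∷ p) + joined x f p)
  ∑-blocks-∷ x xs f = trans (∑-concatMap _ (blocks xs) f) (∑-cong (blocks xs) λ
    { []      → refl
    ; (_ ∷ _) → +-cong refl (+-identityʳ _)
    })

  overSplits′ : (Blocks → Blocks → Carrier) → Blocks → Carrier
  overSplits′ Φ p = ∑ (splits′ p) (uncurry Φ)

  overSplitBlocks : (Blocks → Blocks → Carrier) → List Carrier → Carrier
  overSplitBlocks Φ xs =
    ∑[ s ∈ splits xs ] ∑[ q ∈ blocks (proj₁ s) ] ∑[ r ∈ blocks (proj₂ s) ] Φ q r

  attachˡ : Carrier → (Blocks → Blocks → Carrier) → Blocks → Blocks → Carrier
  attachˡ x Φ q r = Φ ([ x ] ∷ q) r + joined x (λ q′ → Φ q′ r) q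

  overSplits′-∷ : ∀ x Φ p →
    overSplits′ Φ ([ x ] ∷ p) + joined x (overSplits′ Φ) p
    ≈ (Φ [] ([ x ] ∷ p) + joined x (Φ []) p) + overSplits′ (attachˡ x Φ) p
  overSplits′-∷ x Φ p = begin
      overSplits′ Φ ([ x ] ∷ p) + joined x (overSplits′ Φ) p
    ≈⟨ +-cong (reflexive (∑-splits′-∷ [ x ] p _)) (joined-overSplits′ p) ⟩
      (Φ [] ([ x ] ∷ p) + ∑ (splits′ p) ownBlock) + (joined x (Φ []) p + ∑ (splits′ p) joinedBlock)
    ≈⟨ interchange _ _ _ _ ⟩
      (Φ [] ([ x ] ∷ p) + joined x (Φ []) p) + (∑ (splits′ p) ownBlock + ∑ (splits′ p) joinedBlock)
    ≈⟨ +-cong refl (∑-+ (splits′ p) ownBlock joinedBlock) ⟨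
      (Φ [] ([ x ] ∷ p) + joined x (Φ []) p) + overSplits′ (attachˡ x Φ) p ∎
    where
    ownBlock joinedBlock : Blocks × Blocks → Carrier
    ownBlock s = Φ ([ x ] ∷ proj₁ s) (proj₂ s)
    joinedBlock s = joined x (λ q → Φ q (proj₂ s)) (proj₁ s)
    joined-overSplits′ : ∀ p →
      joined x (overSplits′ Φ) p ≈ joined x (Φ []) p + ∑ (splits′ p) joinedBlock
    joined-overSplits′ []       = sym (trans (+-identityˡ _) (+-identityˡ _))
    joined-overSplits′ (q ∷ qs) = trans (reflexive (∑-splits′-∷ (x ∷ q) qs _))
      (+-cong refl (trans (sym (+-identityˡ _)) (reflexive (≡.sym (∑-splits′-∷ q qs _)))))

  overSplitBlocks-∷ : ∀ x xs Φ →
    overSplitBlocks Φ (x ∷ xs) ≈ ∑ (blocks (x ∷ xs)) (Φ []) + overSplitBlocks (attachˡ x Φ) xs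
  overSplitBlocks-∷ x xs Φ = trans (reflexive (∑-splits-∷ x xs _))
    (+-cong (+-identityʳ _) (∑-cong (splits xs) λ s → ∑-blocks²-∷ (proj₁ s) (proj₂ s)))
    where
    ∑-blocks²-∷ : ∀ ys zs → ∑[ q ∈ blocks (x ∷ ys) ] ∑[ r ∈ blocks zs ] Φ q r
                           ≈ ∑[ q ∈ blocks ys ] ∑[ r ∈ blocks zs ] attachˡ x Φ q r
    ∑-blocks²-∷ ys zs = trans (∑-blocks-∷ x ys _) (∑-cong (blocks ys) λ q →
        sym (trans (∑-+ (blocks zs) _ _) (+-cong refl (∑-joined q))))
      where
      ∑-joined : ∀ q → ∑[ r ∈ blocks zs ] joined x (λ q′ → Φ q′ r) q
                       ≈ joined x (λ q′ → ∑[ r ∈ blocks zs ] Φ q′ r) q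
      ∑-joined []      = ∑-zero (blocks zs) (λ _ → refl)
      ∑-joined (_ ∷ _) = refl

  ∑-blocks-overSplits′ : ∀ xs Φ → ∑ (blocks xs) (overSplits′ Φ) ≈ overSplitBlocks Φ xs
  ∑-blocks-overSplits′ []       Φ = sym (+-identityʳ _)
  ∑-blocks-overSplits′ (x ∷ xs) Φ = begin
      ∑ (blocks (x ∷ xs)) (overSplits′ Φ)
    ≈⟨ ∑-blocks-∷ x xs (overSplits′ Φ) ⟩
      ∑[ p ∈ blocks xs ] (overSplits′ Φ ([ x ] ∷ p) + joined x (overSplits′ Φ) p)
    ≈⟨ ∑-cong (blocks xs) (overSplits′-∷ x Φ) ⟩
      ∑[ p ∈ blocks xs ] ((Φ [] ([ x ] ∷ p) + joined x (Φ []) p) + overSplits′ (attachˡ x Φ) p)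
    ≈⟨ ∑-+ (blocks xs) _ _ ⟩
      ∑[ p ∈ blocks xs ] (Φ [] ([ x ] ∷ p) + joined x (Φ []) p)
        + ∑ (blocks xs) (overSplits′ (attachˡ x Φ))
    ≈⟨ +-cong (sym (∑-blocks-∷ x xs (Φ []))) (∑-blocks-overSplits′ xs (attachˡ x Φ)) ⟩
      ∑ (blocks (x ∷ xs)) (Φ []) + overSplitBlocks (attachˡ x Φ) xs
    ≈⟨ overSplitBlocks-∷ x xs Φ ⟨
      overSplitBlocks Φ (x ∷ xs) ∎

  ·-map : ∀ f k g (p : Blocks) →
          (f · k) (map g p) ≡ overSplits′ (λ q r → f (map g q) * k (map g r)) p
  ·-map f k g p = ≡.trans (≡.cong (λ l → ∑ l (uncurry λ ys zs → f ys * k zs)) (splits-map g p))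
                          (∑-map _ (splits′ p) _)

  ⊚-distribʳ-· : ∀ f k g → (f · k) ⊚ g ≋ (f ⊚ g) · (k ⊚ g)
  ⊚-distribʳ-· f k g xs = begin
      ((f · k) ⊚ g) xs
    ≈⟨ ∑-cong (blocks xs) (λ p → reflexive (·-map f k g p)) ⟩
      ∑ (blocks xs) (overSplits′ Φ)
    ≈⟨ ∑-blocks-overSplits′ xs Φ ⟩
      overSplitBlocks Φ xs
    ≈⟨ ∑-cong (splits xs) (λ s → ∑-*-∑ (blocks (proj₁ s)) (blocks (proj₂ s)) _ _) ⟨
      ((f ⊚ g) · (k ⊚ g)) xs ∎
    where
    Φ : Blocks → Blocks → Carrier
    Φ q r = f (map g q) * k (map g r)

  I·-[] : ∀ X → (I · X) [] ≈ 0#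
  I·-[] X = trans (+-identityʳ _) (zeroˡ _)

  I·-∷ : ∀ X y ys → (I · X) (y ∷ ys) ≈ y * X ys
  I·-∷ X y []       = trans (+-cong (zeroˡ _) (+-identityʳ _)) (+-identityˡ _)
  I·-∷ X y (z ∷ zs) = begin
      (I · X) (y ∷ z ∷ zs)
    ≈⟨ trans (·-∷ I X y (z ∷ zs)) (+-cong (zeroˡ _) (·-∷ (λ ws → I (y ∷ ws)) X z zs)) ⟩
      0# + (y * X (z ∷ zs) + ∑[ s ∈ splits zs ] (0# * X (proj₂ s)))
    ≈⟨ trans (+-identityˡ _) (+-cong refl (∑-zero (splits zs) (λ _ → zeroˡ _))) ⟩
      y * X (z ∷ zs) + 0#
    ≈⟨ +-identityʳ _ ⟩
      y * X (z ∷ zs) ∎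

  I-1#∷≡𝟙 : ∀ xs → I (1# ∷ xs) ≡ 𝟙 xs
  I-1#∷≡𝟙 []      = ≡.refl
  I-1#∷≡𝟙 (_ ∷ _) = ≡.refl

  I·-cancelˡ : ∀ X → I · X ≋ I → X ≋ 𝟙
  I·-cancelˡ X I·X≋I xs = begin
    X xs              ≈⟨ *-identityˡ _ ⟨
    1# * X xs         ≈⟨ I·-∷ X 1# xs ⟨
    (I · X) (1# ∷ xs) ≈⟨ I·X≋I (1# ∷ xs) ⟩
    I (1# ∷ xs)       ≡⟨ I-1#∷≡𝟙 xs ⟩
    𝟙 xs              ∎

  ⊚≋I⇒[]≈0# : ∀ f g → f ⊚ g ≋ I → f [] ≈ 0#
  ⊚≋I⇒[]≈0# f g f⊚g≋I = trans (sym (+-identityʳ _)) (f⊚g≋I [])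

  Shorter : List Carrier → Blocks → Set b
  Shorter xs = All (λ q → length q < length xs)

  ∑-blocks-one-block : ∀ y ys (D : Blocks → Carrier) →
    (∀ q₁ q₂ qs → Shorter (y ∷ ys) (q₁ ∷ q₂ ∷ qs) → D (q₁ ∷ q₂ ∷ qs) ≈ 0#) →
    ∑ (blocks (y ∷ ys)) D ≈ D [ y ∷ ys ]
  ∑-blocks-one-block y []       D _          = +-identityʳ _
  ∑-blocks-one-block y (z ∷ zs) D D-vanishes = begin
      ∑ (blocks (y ∷ z ∷ zs)) D
    ≈⟨ ∑-blocks-∷ y (z ∷ zs) D ⟩
      ∑[ p ∈ blocks (z ∷ zs) ] (D ([ y ] ∷ p) + joined y D p)
    ≈⟨ ∑-blocks-one-block z zs _ D′-vanishes ⟩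
      D ([ y ] ∷ [ z ∷ zs ]) + D [ y ∷ z ∷ zs ]
    ≈⟨ +-cong (D-vanishes _ _ _ ([y]-short ∷ n<1+n _ ∷ [])) refl ⟩
      0# + D [ y ∷ z ∷ zs ]
    ≈⟨ +-identityˡ _ ⟩
      D [ y ∷ z ∷ zs ] ∎
    where
    [y]-short : length [ y ] < length (y ∷ z ∷ zs)
    [y]-short = s≤s (s≤s z≤n)
    widen : ∀ {p} → Shorter (z ∷ zs) p → Shorter (y ∷ z ∷ zs) p
    widen = All.map m<n⇒m<1+n
    D′-vanishes : ∀ q₁ q₂ qs → Shorter (z ∷ zs) (q₁ ∷ q₂ ∷ qs) →
                  D ([ y ] ∷ q₁ ∷ q₂ ∷ qs) + D ((y ∷ q₁) ∷ q₂ ∷ qs) ≈ 0#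
    D′-vanishes _ _ _ short@(q₁-short ∷ qs-short) = trans
      (+-cong (D-vanishes _ _ _ ([y]-short ∷ widen short))
              (D-vanishes _ _ _ (s≤s q₁-short ∷ widen qs-short)))
      (+-identityʳ 0#)

  I-⊚ : ∀ g → g [] ≈ 0# → I ⊚ g ≋ g
  I-⊚ g g₀≈0 []       = trans (+-identityʳ _) (sym g₀≈0)
  I-⊚ g _    (y ∷ ys) = ∑-blocks-one-block y ys _ (λ _ _ _ _ → refl)

  I·F⊚-cancelˡ : ∀ {F u h₁ h₂} → Congruent F → F [] * u ≈ 1# → h₁ [] ≈ 0# → h₂ [] ≈ 0# →
                 (I · F) ⊚ h₁ ≋ (I · F) ⊚ h₂ → h₁ ≋ h₂
  I·F⊚-cancelˡ {F} {u} {h₁} {h₂} F-cong F₀u≈1 h₁₀≈0 h₂₀≈0 I·F⊚h₁≋I·F⊚h₂ =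
    WF.All.wfRec (On.wellFounded length <-wellFounded) _ (λ xs → h₁ xs ≈ h₂ xs) agree
    where
    agree : ∀ xs → (∀ {ys} → length ys < length xs → h₁ ys ≈ h₂ ys) → h₁ xs ≈ h₂ xs
    agree []       _  = trans h₁₀≈0 (sym h₂₀≈0)
    agree (y ∷ ys) ih = begin
        h₁ (y ∷ ys)             ≈⟨ cancelʳ F₀u≈1 _ ⟨
        h₁ (y ∷ ys) * F [] * u  ≈⟨ *-cong h₁F₀≈h₂F₀ refl ⟩
        h₂ (y ∷ ys) * F [] * u  ≈⟨ cancelʳ F₀u≈1 _ ⟩
        h₂ (y ∷ ys)             ∎
      where
      D : Blocks → Carrier
      D p = (I · F) (map h₁ p) - (I · F) (map h₂ p)
      D-vanishes : ∀ q₁ q₂ qs → Shorter (y ∷ ys) (q₁ ∷ q₂ ∷ qs) → D (q₁ ∷ q₂ ∷ qs) ≈ 0#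
      D-vanishes _ _ _ short =
        x≈y⇒x∙y⁻¹≈ε (·-congruent I-congruent F-cong (map-pointwise (All.map ih short)))
      D-one-block≈0 : D [ y ∷ ys ] ≈ 0#
      D-one-block≈0 = begin
        D [ y ∷ ys ]               ≈⟨ ∑-blocks-one-block y ys D D-vanishes ⟨
        ∑ (blocks (y ∷ ys)) D      ≈⟨ ∑-- (blocks (y ∷ ys)) _ _ ⟩
        ((I · F) ⊚ h₁) (y ∷ ys) - ((I · F) ⊚ h₂) (y ∷ ys) ≈⟨ x≈y⇒x∙y⁻¹≈ε (I·F⊚h₁≋I·F⊚h₂ (y ∷ ys)) ⟩
        0#                         ∎
      h₁F₀≈h₂F₀ : h₁ (y ∷ ys) * F [] ≈ h₂ (y ∷ ys) * F []
      h₁F₀≈h₂F₀ = begin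
        h₁ (y ∷ ys) * F []         ≈⟨ I·-∷ F _ [] ⟨
        (I · F) [ h₁ (y ∷ ys) ]    ≈⟨ x∙y⁻¹≈ε⇒x≈y _ _ D-one-block≈0 ⟩
        (I · F) [ h₂ (y ∷ ys) ]    ≈⟨ I·-∷ F _ [] ⟩
        h₂ (y ∷ ys) * F []         ∎

module Conjugation {c ℓ b ℓb} {K : CommutativeRing c ℓ} (A : UnitalAlgebra K b ℓb) where
  open MultSeries A
  open MultSeriesProperties A
  open MonoidProperties ·-monoid using (cancelˡ; elimʳ)
  open import Relation.Binary.Reasoning.Setoid (Monoid.setoid ·-monoid)

  module _ {F S S⁻¹ : Mult} (I·F⊚I·S≋I : (I · F) ⊚ (I · S) ≋ I) (S⁻¹·S≋𝟙 : S⁻¹ · S ≋ 𝟙) where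

    S·F⊚I·S≋𝟙 : S · (F ⊚ (I · S)) ≋ 𝟙
    S·F⊚I·S≋𝟙 = I·-cancelˡ _ (begin
      I · (S · F ⊚ (I · S))          ≈⟨ ·-assoc I S _ ⟨
      (I · S) · F ⊚ (I · S)          ≈⟨ ·-cong (I-⊚ (I · S) (I·-[] S)) ≋-refl ⟨
      (I ⊚ (I · S)) · (F ⊚ (I · S))  ≈⟨ ⊚-distribʳ-· I F (I · S) ⟨
      (I · F) ⊚ (I · S)              ≈⟨ I·F⊚I·S≋I ⟩
      I                              ∎)

    F⊚I·S≋S⁻¹ : F ⊚ (I · S) ≋ S⁻¹
    F⊚I·S≋S⁻¹ = begin
      F ⊚ (I · S)              ≈⟨ cancelˡ S⁻¹·S≋𝟙 _ ⟨
      S⁻¹ · (S · F ⊚ (I · S))  ≈⟨ elimʳ S·F⊚I·S≋𝟙 S⁻¹ ⟩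
      S⁻¹                      ∎

    S⁻¹·I·S≋F·I⊚I·S : S⁻¹ · I · S ≋ (F · I) ⊚ (I · S)
    S⁻¹·I·S≋F·I⊚I·S = begin
      S⁻¹ · I · S                    ≈⟨ ·-assoc S⁻¹ I S ⟩
      S⁻¹ · (I · S)                  ≈⟨ ·-cong F⊚I·S≋S⁻¹ (I-⊚ (I · S) (I·-[] S)) ⟨
      (F ⊚ (I · S)) · (I ⊚ (I · S))  ≈⟨ ⊚-distribʳ-· F I (I · S) ⟨
      (F · I) ⊚ (I · S)              ∎

corollary3p6 : ∀ {c ℓ b ℓb} (K : CommutativeRing c ℓ) → IsField K → CharacteristicZero K →
    (A : UnitalAlgebra K b ℓb) →
    let open MultSeries A in
    (F : Mult) → IsMultilinear F → InGinv F →
    -- S = S_f : the element of G^inv_B with f^{∘-1} = I·S_f, where f = I·F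
    (S : Mult) → IsMultilinear S → InGinv S → IsCompInverse (I · F) (I · S) →
    -- Sinv = inverse of S_f under the product
    (Sinv : Mult) → IsMultilinear Sinv → IsMulInverse S Sinv →
    -- h = (I·F)^{∘-1}
    (h : Mult) → IsMultilinear h → IsCompInverse (I · F) h →
    ((Sinv · I · S ≋ (F · I) ⊚ (I · S)) × ((F · I) ⊚ (I · S) ≋ (F · I) ⊚ h))
corollary3p6 K _ _ A F F-multilinear (_ , F₀u≈1 , _) S _ _ (I·F⊚I·S≋I , _) Sinv _ (_ , Sinv·S≋𝟙)
             h _ (I·F⊚h≋I , h⊚I·F≋I) =
  S⁻¹·I·S≋F·I⊚I·S I·F⊚I·S≋I Sinv·S≋𝟙 , ⊚-congʳ (·-congruent F-cong I-congruent) I·S≋h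
  where
  open MultSeries A
  open MultSeriesProperties A
  open Conjugation A

  F-cong : Congruent F
  F-cong = IsMultilinear.cong F-multilinear

  I·S≋h : I · S ≋ h
  I·S≋h = I·F⊚-cancelˡ F-cong F₀u≈1 (I·-[] S) (⊚≋I⇒[]≈0# h (I · F) h⊚I·F≋I)
                        (≋-trans I·F⊚I·S≋I (≋-sym I·F⊚h≋I))
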